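{- Let $p$ be a prime. For $x,y,z\in\mathbb{Z}/p\mathbb{Z}$ with $xyz\neq 0$, let $R_{x,y,z}\colon W\to\mathbb{C}$ be the linear functional \[ R_{x,y,z}(f)=f(1:x:y)+f(1:y:z)+f(1:z:x)-f\!\left(1:\tfrac{y}{x}:\tfrac{z}{x}\right). \] Then $R_{x,y,z}$ annihilates $W^{\mathrm{nc}}$, i.e. $R_{x,y,z}(g)=0$ for every $g\in W^{\mathrm{nc}}$.
   Context: Let $p$ be a prime. $W$ denotes the complex vector space of functions $f\colon\mathbb{P}^2(\mathbb{Z}/p\mathbb{Z})\to\mathbb{C}$ satisfying (i) $f(x:y:z)=f(z:x:y)=f(-x:y:z)=-f(y:x:z)$ and (ii) $f(x:y:z)+f(-y:x-y:z)+f(y-x:-x:z)=0$ for all points. $W_0$ denotes the complex vector space of functions $f\colon\mathbb{P}^1(\mathbb{Z}/p\mathbb{Z})\to\mathbb{C}$ satisfying (i) $f(x:y)=f(-x:y)=-f(y:x)$, (ii) $f(x:y)+f(-y:x-y)+f(y-x:-x)=0$, (iii) $f(1:0)=0$. For $f\in W_0$ set $f(0:0)=0$, and define linear maps $\alpha,\beta\colon W_0\to W$ by $(\alpha f)(x:y:z)=f(x:y)+f(y:z)+f(z:x)$, and $(\beta f)(x:y:z)=0$ if $xyz\neq0$, $=f(x:y)$ if $z=0$, $=f(y:z)$ if $x=0$, $=f(z:x)$ if $y=0$. Define $W^{\mathrm{nc}}=\alpha(W_0)+\beta(W_0)\subseteq W$. (Here $W$ is isomorphic to $H_3(\Gamma_0(3,p),\mathbb{C})$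 and $W^{\mathrm{nc}}$ corresponds to the non-cuspidal part; the functional $R_{x,y,z}$ is the pairing with the combination of unimodular symbols $[Q_{x,y}]+[Q_{y,z}]+[Q_{z,x}]-[Q_{y/x,z/x}]$, where $Q_{a,b}$ is the matrix with rows $(1,0,0),(a,1,0),(b,0,1)$ and $[Q](f)$ is $f$ evaluated at the first column of $Q$.) -}

module Defs where

open import Level using (_⊔_)
open import Data.Nat as ℕ using (ℕ; zero; suc; NonZero)
open import Data.Nat.DivMod using (_mod_)
open import Data.Fin as Fin using (Fin; toℕ)
open import Data.Product using (_×_; ∃)
open import Relation.Nullary using (¬_; yes; no)
open import Relation.Binary.PropositionalEquality using (_≡_; _≢_)
open import Algebra.Bundles using (CommutativeRing)

module ModP (p : ℕ) .{{_ : NonZero p}} where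
  F : Set
  F = Fin p

  0ₚ 1ₚ : F
  0ₚ = 0 mod p
  1ₚ = 1 mod p

  infixl 6 _+ₚ_ _-ₚ_
  infixl 7 _*ₚ_
  _+ₚ_ _*ₚ_ _-ₚ_ : F → F → F
  a +ₚ b = (toℕ a ℕ.+ toℕ b) mod p
  a *ₚ b = (toℕ a ℕ.* toℕ b) mod p
  negₚ : F → F
  negₚ a = (p ℕ.∸ toℕ a) mod p
  a -ₚ b = a +ₚ negₚ b

  -- (x,y) resp. (x,y,z) is a nonzero vector, i.e. represents a projective point
  NZ2 : F → F → Set
  NZ2 x y = ¬ (x ≡ 0ₚ × y ≡ 0ₚ)
  NZ3 : F → F → F → Set
  NZ3 x y z = ¬ (x ≡ 0ₚ × y ≡ 0ₚ × z ≡ 0ₚ)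

module _ {c ℓ} (K : CommutativeRing c ℓ) where
  open CommutativeRing K
  natCast : ℕ → Carrier
  natCast zero = 0#
  natCast (suc n) = 1# + natCast n

-- K is a field of characteristic zero (ℂ is one; stdlib has no ℂ)
record IsCharZeroField {c ℓ} (K : CommutativeRing c ℓ) : Set (c ⊔ ℓ) where
  open CommutativeRing K
  field
    1≉0   : ¬ (1# ≈ 0#)
    inv   : ∀ x → ¬ (x ≈ 0#) → ∃ λ y → x * y ≈ 1#
    char0 : ∀ n → natCast K n ≈ 0# → n ≡ 0

-- A function on ℙ²(𝔽_p) is a function on triples that is invariant
-- under nonzero scaling on nonzero triples (value at (0,0,0) irrelevant).
module Spaces {c ℓ} (K : CommutativeRing c ℓ) (p : ℕ) .{{_ : NonZero p}} where
  open CommutativeRing K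
  open ModP p

  Fun3 : Set c
  Fun3 = F → F → F → Carrier
  Fun2 : Set c
  Fun2 = F → F → Carrier

  record InW (f : Fun3) : Set (c ⊔ ℓ) where
    field
      proj  : ∀ t x y z → t ≢ 0ₚ → NZ3 x y z →
              f (t *ₚ x) (t *ₚ y) (t *ₚ z) ≈ f x y z
      cyc   : ∀ x y z → NZ3 x y z → f x y z ≈ f z x y
      neg   : ∀ x y z → NZ3 x y z → f x y z ≈ f (negₚ x) y z
      swap  : ∀ x y z → NZ3 x y z → f x y z ≈ - f y x z
      three : ∀ x y z → NZ3 x y z →
              f x y z + f (negₚ y) (x -ₚ y) z + f (y -ₚ x) (negₚ x) z ≈ 0#

  record InW0 (f : Fun2) : Set (c ⊔ ℓ) where
    field
      proj  : ∀ t x y → t ≢ 0ₚ → NZ2 x y → f (t *ₚ x) (t *ₚ y) ≈ f x y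
      neg   : ∀ x y → NZ2 x y → f x y ≈ f (negₚ x) y
      swap  : ∀ x y → NZ2 x y → f x y ≈ - f y x
      three : ∀ x y → NZ2 x y → f x y + f (negₚ y) (x -ₚ y) + f (y -ₚ x) (negₚ x) ≈ 0#
      at10  : f 1ₚ 0ₚ ≈ 0#

  ext : Fun2 → Fun2
  ext f x y with x Fin.≟ 0ₚ | y Fin.≟ 0ₚ
  ... | yes _ | yes _ = 0#
  ... | _     | _     = f x y

  α : Fun2 → Fun3
  α f x y z = ext f x y + ext f y z + ext f z x

  β : Fun2 → Fun3
  β f x y z with z Fin.≟ 0ₚ | x Fin.≟ 0ₚ | y Fin.≟ 0ₚ
  ... | yes _ | _     | _     = ext f x y
  ... | no _  | yes _ | _     = ext f y z
  ... | no _  | no _  | yes _ = ext f z x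
  ... | no _  | no _  | no _  = 0#

  -- R_{x,y,z}(h) = h(1:x:y) + h(1:y:z) + h(1:z:x) - h(1:u:v),
  -- where u = y/x and v = z/x are passed explicitly.
  R : Fun3 → F → F → F → F → F → Carrier
  R h x y z u v = h 1ₚ x y + h 1ₚ y z + h 1ₚ z x - h 1ₚ u v

{-# OPTIONS --safe #-}
module Submission where

-- On a point (1:a:b) with a, b ≠ 0 the β-part vanishes and α f takes the value
-- f(1:a) + f(a:b) + f(b:1).  For the three points of R_{x,y,z} the antisymmetry of f
-- telescopes the terms f(1:·) + f(·:1) away, leaving f(x:y) + f(y:z) + f(z:x), and
-- projective invariance (divide by x) identifies this with f(1:u) + f(u:v) + f(v:1),
-- the value at the fourth point (1:u:v).

open import Defs
open import Data.Nat using (ℕ; NonZero; _<_; _*_; _%_; nonTrivial⇒n>1; >-nonZero⁻¹)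
open import Data.Nat.Properties using (*-zeroʳ; *-identityʳ)
open import Data.Nat.DivMod using (_mod_; m<n⇒m%n≡m)
open import Data.Nat.Primality using (Prime; prime⇒nonTrivial)
open import Data.Fin as Fin using (toℕ)
open import Data.Fin.Properties using (toℕ-fromℕ<; toℕ-injective; toℕ<n)
open import Data.Product using (_,_)
open import Data.Empty using (⊥-elim)
open import Relation.Nullary using (yes; no)
open import Relation.Binary.PropositionalEquality as ≡ using (_≡_; _≢_)
open import Algebra.Bundles using (CommutativeMonoid; CommutativeRing)
import Algebra.Solver.CommutativeMonoid as CommutativeMonoidSolver
import Algebra.Properties.Ring as RingProperties
import Relation.Binary.Reasoning.Setoid as SetoidReasoning

module _ (p : ℕ) .{{_ : NonZero p}} where
  open ModP p

  toℕ-mod : ∀ n → toℕ (n mod p) ≡ n % p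
  toℕ-mod n = toℕ-fromℕ< _

  toℕ-0ₚ : toℕ 0ₚ ≡ 0
  toℕ-0ₚ = ≡.trans (toℕ-mod 0) (m<n⇒m%n≡m (>-nonZero⁻¹ p))

  *ₚ-zeroʳ : ∀ x → x *ₚ 0ₚ ≡ 0ₚ
  *ₚ-zeroʳ x = ≡.cong (_mod p) (≡.trans (≡.cong (toℕ x *_) toℕ-0ₚ) (*-zeroʳ (toℕ x)))

  x*ₚy≢0⇒y≢0 : ∀ x {y} → x *ₚ y ≢ 0ₚ → y ≢ 0ₚ
  x*ₚy≢0⇒y≢0 x xy≢0 ≡.refl = xy≢0 (*ₚ-zeroʳ x)

  module _ (1<p : 1 < p) where

    toℕ-1ₚ : toℕ 1ₚ ≡ 1
    toℕ-1ₚ = ≡.trans (toℕ-mod 1) (m<n⇒m%n≡m 1<p)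

    1ₚ≢0ₚ : 1ₚ ≢ 0ₚ
    1ₚ≢0ₚ 1≡0 with () ← ≡.trans (≡.sym toℕ-1ₚ) (≡.trans (≡.cong toℕ 1≡0) toℕ-0ₚ)

    *ₚ-identityʳ : ∀ x → x *ₚ 1ₚ ≡ x
    *ₚ-identityʳ x = toℕ-injective (begin
      toℕ (x *ₚ 1ₚ)         ≡⟨ toℕ-mod _ ⟩
      (toℕ x * toℕ 1ₚ) % p  ≡⟨ ≡.cong (λ n → (toℕ x * n) % p) toℕ-1ₚ ⟩
      (toℕ x * 1) % p       ≡⟨ ≡.cong (_% p) (*-identityʳ (toℕ x)) ⟩
      toℕ x % p             ≡⟨ m<n⇒m%n≡m (toℕ<n x) ⟩
      toℕ x                 ∎)
      where open ≡.≡-Reasoning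

module _ {c ℓ} (M : CommutativeMonoid c ℓ) where
  open CommutativeMonoid M
  open CommutativeMonoidSolver M using (solve; _⊜_; _⊕_)
  open SetoidReasoning setoid

  telescope : ∀ {a a′ b b′ c c′} → a ∙ a′ ≈ ε → b ∙ b′ ≈ ε → c ∙ c′ ≈ ε → ∀ P Q S →
              (a ∙ P ∙ b′) ∙ (b ∙ Q ∙ c′) ∙ (c ∙ S ∙ a′) ≈ P ∙ Q ∙ S
  telescope {a} {a′} {b} {b′} {c} {c′} aa′≈ε bb′≈ε cc′≈ε P Q S = begin
    (a ∙ P ∙ b′) ∙ (b ∙ Q ∙ c′) ∙ (c ∙ S ∙ a′)    ≈⟨ regroup a a′ b b′ c c′ P Q S ⟩
    (a ∙ a′) ∙ ((b ∙ b′) ∙ ((c ∙ c′) ∙ (P ∙ Q ∙ S))) ≈⟨ ∙-cong aa′≈ε (∙-cong bb′≈ε (∙-congʳ cc′≈ε)) ⟩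
    ε ∙ (ε ∙ (ε ∙ (P ∙ Q ∙ S)))                      ≈⟨ trans (identityˡ _) (trans (identityˡ _) (identityˡ _)) ⟩
    P ∙ Q ∙ S                                        ∎
    where
    regroup = solve 9 (λ a a′ b b′ c c′ P Q S →
      (((a ⊕ P) ⊕ b′) ⊕ ((b ⊕ Q) ⊕ c′)) ⊕ ((c ⊕ S) ⊕ a′) ⊜
      (a ⊕ a′) ⊕ (b ⊕ b′) ⊕ (c ⊕ c′) ⊕ ((P ⊕ Q) ⊕ S)) refl

module _ {c ℓ} (K : CommutativeRing c ℓ) (p : ℕ) .{{_ : NonZero p}} where
  open CommutativeRing K hiding (_*_)
  open ModP p
  open Spaces K p
  open SetoidReasoning setoid

  ≢0ˡ⇒NZ2 : ∀ {a b} → a ≢ 0ₚ → NZ2 a b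
  ≢0ˡ⇒NZ2 a≢0 (a≡0 , _) = a≢0 a≡0

  ≢0ʳ⇒NZ2 : ∀ {a b} → b ≢ 0ₚ → NZ2 a b
  ≢0ʳ⇒NZ2 b≢0 (_ , b≡0) = b≢0 b≡0

  ext-NZ2 : ∀ f {a b} → NZ2 a b → ext f a b ≈ f a b
  ext-NZ2 f {a} {b} nz with a Fin.≟ 0ₚ | b Fin.≟ 0ₚ
  ... | yes a≡0 | yes b≡0 = ⊥-elim (nz (a≡0 , b≡0))
  ... | yes _   | no _    = refl
  ... | no _    | yes _   = refl
  ... | no _    | no _    = refl

  β-off-axes : ∀ f {a b d} → a ≢ 0ₚ → b ≢ 0ₚ → d ≢ 0ₚ → β f a b d ≈ 0#
  β-off-axes f {a} {b} {d} a≢0 b≢0 d≢0 with d Fin.≟ 0ₚ | a Fin.≟ 0ₚ | b Fin.≟ 0ₚ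
  ... | yes d≡0 | _       | _       = ⊥-elim (d≢0 d≡0)
  ... | no _    | yes a≡0 | _       = ⊥-elim (a≢0 a≡0)
  ... | no _    | no _    | yes b≡0 = ⊥-elim (b≢0 b≡0)
  ... | no _    | no _    | no _    = refl

  triangle : Fun2 → F → F → Carrier
  triangle f a b = f 1ₚ a + f a b + f b 1ₚ

  α-at-1 : ∀ f {a b} → a ≢ 0ₚ → b ≢ 0ₚ → α f 1ₚ a b ≈ triangle f a b
  α-at-1 f a≢0 b≢0 = +-cong (+-cong (ext-NZ2 f (≢0ʳ⇒NZ2 a≢0)) (ext-NZ2 f (≢0ˡ⇒NZ2 a≢0)))
                            (ext-NZ2 f (≢0ˡ⇒NZ2 b≢0))

  antisym-sum : ∀ {f} → InW0 f → ∀ {a b} → NZ2 a b → f a b + f b a ≈ 0#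
  antisym-sum {f} f∈W0 {a} {b} nz = begin
    f a b + f b a    ≈⟨ +-congʳ (InW0.swap f∈W0 a b nz) ⟩
    - f b a + f b a  ≈⟨ -‿inverseˡ (f b a) ⟩
    0#               ∎

  module _ (1<p : 1 < p) where

    α+β-at-1 : ∀ f g {a b} → a ≢ 0ₚ → b ≢ 0ₚ → α f 1ₚ a b + β g 1ₚ a b ≈ triangle f a b
    α+β-at-1 f g {a} {b} a≢0 b≢0 = begin
      α f 1ₚ a b + β g 1ₚ a b  ≈⟨ +-cong (α-at-1 f a≢0 b≢0) (β-off-axes g (1ₚ≢0ₚ p 1<p) a≢0 b≢0) ⟩
      triangle f a b + 0#      ≈⟨ +-identityʳ _ ⟩
      triangle f a b           ∎

    triangle-cocycle : ∀ {f} → InW0 f → ∀ {x u v} → x ≢ 0ₚ → u ≢ 0ₚ → v ≢ 0ₚ →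
      triangle f x (x *ₚ u) + triangle f (x *ₚ u) (x *ₚ v) + triangle f (x *ₚ v) x
        ≈ triangle f u v
    triangle-cocycle {f} f∈W0 {x} {u} {v} x≢0 u≢0 v≢0 = begin
      triangle f x y + triangle f y z + triangle f z x
        ≈⟨ telescope +-commutativeMonoid antisym antisym antisym _ _ _ ⟩
      f x y + f y z + f z x
        ≡⟨ ≡.cong (λ w → f w y + f y z + f z w) (≡.sym (*ₚ-identityʳ p 1<p x)) ⟩
      f (x *ₚ 1ₚ) y + f y z + f z (x *ₚ 1ₚ)
        ≈⟨ +-cong (+-cong (rescale (≢0ʳ⇒NZ2 u≢0)) (rescale (≢0ʳ⇒NZ2 v≢0))) (rescale (≢0ˡ⇒NZ2 v≢0)) ⟩
      triangle f u v
        ∎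
      where
      y = x *ₚ u
      z = x *ₚ v
      antisym : ∀ {a} → f 1ₚ a + f a 1ₚ ≈ 0#
      antisym = antisym-sum f∈W0 (≢0ˡ⇒NZ2 (1ₚ≢0ₚ p 1<p))
      rescale : ∀ {a b} → NZ2 a b → f (x *ₚ a) (x *ₚ b) ≈ f a b
      rescale = InW0.proj f∈W0 x _ _ x≢0

    R-α+β≈0 : ∀ {f g} → InW0 f → ∀ {x u v} → x ≢ 0ₚ → x *ₚ u ≢ 0ₚ → x *ₚ v ≢ 0ₚ →
              R (λ a b d → α f a b d + β g a b d) x (x *ₚ u) (x *ₚ v) u v ≈ 0#
    R-α+β≈0 {f} {g} f∈W0 {x} {u} {v} x≢0 y≢0 z≢0 = begin
      R (λ a b d → α f a b d + β g a b d) x y z u v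
        ≈⟨ +-cong (+-cong (+-cong (on-torus x≢0 y≢0) (on-torus y≢0 z≢0)) (on-torus z≢0 x≢0))
                  (-‿cong (on-torus u≢0 v≢0)) ⟩
      triangle f x y + triangle f y z + triangle f z x - triangle f u v
        ≈⟨ x≈y⇒x∙y⁻¹≈ε (triangle-cocycle f∈W0 x≢0 u≢0 v≢0) ⟩
      0#
        ∎
      where
      open RingProperties ring using (x≈y⇒x∙y⁻¹≈ε)
      y = x *ₚ u
      z = x *ₚ v
      u≢0 = x*ₚy≢0⇒y≢0 p x y≢0
      v≢0 = x*ₚy≢0⇒y≢0 p x z≢0
      on-torus : ∀ {a b} → a ≢ 0ₚ → b ≢ 0ₚ → α f 1ₚ a b + β g 1ₚ a b ≈ triangle f a b
      on-torus = α+β-at-1 f g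

theorem3p2 : ∀ {c ℓ} (K : CommutativeRing c ℓ) → IsCharZeroField K →
    (p : ℕ) .{{_ : NonZero p}} → Prime p →
    let open CommutativeRing K
        open ModP p
        open Spaces K p
    in ∀ (f₁ f₂ : Fun2) → InW0 f₁ → InW0 f₂ →
       ∀ (x y z u v : F) → x ≢ 0ₚ → y ≢ 0ₚ → z ≢ 0ₚ →
       x *ₚ u ≡ y → x *ₚ v ≡ z →
       R (λ a b d → α f₁ a b d + β f₂ a b d) x y z u v ≈ 0#
theorem3p2 K _ p p-prime f₁ f₂ f₁∈W0 _ x _ _ u v x≢0 y≢0 z≢0 ≡.refl ≡.refl =
  R-α+β≈0 K p (nonTrivial⇒n>1 p {{prime⇒nonTrivial p-prime}}) f₁∈W0 x≢0 y≢0 z≢0
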